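{- Let $\mathbb{F}_q$ be a finite field of characteristic $p$ and let $m$ be a positive integer with $m\not\equiv 0\pmod p$ and $m\not\equiv 1\pmod p$. Then $\tilde{P}_m(0)=\tilde{P}_m(1)$.
   Context: $\tilde{P}_m(z)$ denotes the number of multisets of $m$ elements of $\mathbb{F}_q^*=\mathbb{F}_q\setminus\{0\}$ (repetitions allowed) whose sum is $z$ (partitions of $z$ into $m$ parts). -}

module Defs where

open import Level using (Level; _⊔_)
open import Algebra.Bundles using (CommutativeRing)
import Algebra.Bundles as AB
import Algebra.Definitions.RawSemiring as RS
open import Data.Nat as ℕ using (ℕ; zero; suc; _∸_; _<_)
open import Data.Fin using (Fin)
import Data.Fin.Properties as FinP
open import Data.Vec using (Vec; []; _∷_; lookup)
open import Data.List using (List; []; _∷_; map; concatMap; upTo; filter; length)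
open import Data.Product using (Σ; ∃; _×_; _,_; proj₁; proj₂)
open import Relation.Nullary using (¬_; Dec; yes; no)
open import Relation.Nullary.Decidable using (_×-dec_)
open import Relation.Binary.PropositionalEquality using (_≡_; refl)

record FiniteField (c ℓ : Level) : Set (Level.suc (c ⊔ ℓ)) where
  field
    cring     : CommutativeRing c ℓ
  open CommutativeRing cring public
  field
    1≉0       : ¬ (1# ≈ 0#)
    inverse   : ∀ x → ¬ (x ≈ 0#) → ∃ λ y → (x * y) ≈ 1#
    q         : ℕ
    enum      : Fin q → Carrier
    enum-inj  : ∀ i j → enum i ≈ enum j → i ≡ j
    enum-surj : ∀ x → ∃ λ i → enum i ≈ x

module _ {c ℓ} (F : FiniteField c ℓ) where
  open FiniteField F
  open RS (AB.Semiring.rawSemiring (CommutativeRing.semiring cring)) using () renaming (_×_ to _·_)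

  _≟F_ : (x y : Carrier) → Dec (x ≈ y)
  x ≟F y with enum-surj x | enum-surj y
  ... | i , ei≈x | j , ej≈y with i FinP.≟ j
  ...   | yes refl = yes (trans (sym ei≈x) ej≈y)
  ...   | no i≢j  = no λ x≈y → i≢j (enum-inj i j (trans ei≈x (trans x≈y (Setoid-sym ej≈y))))
    where Setoid-sym = CommutativeRing.sym cring

  IsCharacteristic : ℕ → Set ℓ
  IsCharacteristic p = (0 < p) × ((p · 1#) ≈ 0#)
                     × (∀ n → 0 < n → n < p → ¬ ((n · 1#) ≈ 0#))

  compositions : (n m : ℕ) → List (Vec ℕ n)
  compositions zero zero = [] ∷ []
  compositions zero (suc m) = []
  compositions (suc n) m =
    concatMap (λ k → map (k ∷_) (compositions n (m ∸ k))) (upTo (suc m))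

  weightedSum : ∀ {n} → Vec ℕ n → (Fin n → Carrier) → Carrier
  weightedSum [] f = 0#
  weightedSum (k ∷ ks) f = (k · f Fin.zero) + weightedSum ks (λ i → f (Fin.suc i))
    where import Data.Fin as Fin

  -- a multiset of elements of F is given by its multiplicity vector c
  -- (c at index i = multiplicity of enum i).
  AvoidsZero : Vec ℕ q → Set ℓ
  AvoidsZero cs = ∀ i → enum i ≈ 0# → lookup cs i ≡ 0

  avoidsZero? : (cs : Vec ℕ q) → Dec (AvoidsZero cs)
  avoidsZero? cs = Relation.Nullary.Decidable.map′ (λ h i e → h i e) (λ h i e → h i e)
                     (FinP.all? λ i → dec i)
    where
      import Relation.Nullary.Decidable
      dec : ∀ i → Dec (enum i ≈ 0# → lookup cs i ≡ 0)
      dec i with enum i ≟F 0# | lookup cs i ℕ.≟ 0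
      ... | _ | yes e = yes (λ _ → e)
      ... | no ne | no _ = yes (λ e → Data.Empty.⊥-elim (ne e))
        where import Data.Empty
      ... | yes e | no ne = no (λ h → ne (h e))

  Ptilde : ℕ → Carrier → ℕ
  Ptilde m z = length (filter (λ cs → avoidsZero? cs ×-dec (weightedSum cs enum ≟F z))
                              (compositions q m))

-- Let P_m(z) count the multisets of m elements of F, zero allowed, with sum z.
-- Removing one copy of 0 shows P_m(z) = P̃_m(z) + P_{m-1}(z).  Translating every
-- element of a multiset by a shifts its sum by m·a, so when m·1 ≠ 0 (choose
-- m·a = 1) we get P_m(0) = P_m(1).  Since p divides neither m nor m - 1, this
-- applies to both P_m and P_{m-1}, and P̃_m(0) = P̃_m(1) follows.
module Submission where

open import Defs
open import Data.Nat as ℕ using (ℕ; zero; suc; _∸_; _<_; s≤s; z≤n)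
import Data.Nat.Properties as ℕₚ
open import Data.Nat.Divisibility using (_∣_; _∣0; m%n≡0⇒n∣m)
open import Data.Nat.DivMod using (_%_; _/_; m≡m%n+[m/n]*n; m%n<n)
open import Data.Fin as Fin using (Fin)
open import Data.Fin.Permutation using (Permutation; permutation; _⟨$⟩ʳ_; _⟨$⟩ˡ_; flip; inverseʳ; inverseˡ)
open import Data.List using (List; []; _∷_; map; filter; length; upTo)
open import Data.List.Properties using (length-map)
open import Data.List.Membership.Propositional using (_∈_; find; lose)
open import Data.List.Membership.Propositional.Properties
  using (∈-map⁺; ∈-map⁻; ∈-filter⁺; ∈-filter⁻; ∈-concatMap⁺; ∈-concatMap⁻; ∈-upTo⁺; ∈-upTo⁻)
open import Data.List.Membership.Propositional.Properties.WithK using (unique∧set⇒bag)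
open import Data.List.Relation.Binary.BagAndSetEquality using (∼bag⇒↭)
open import Data.List.Relation.Binary.Permutation.Propositional.Properties using (↭-length)
open import Data.List.Relation.Unary.Any using (here)
import Data.List.Relation.Unary.All as All
import Data.List.Relation.Unary.All.Properties as Allₚ
import Data.List.Relation.Unary.AllPairs as AllPairs
import Data.List.Relation.Unary.AllPairs.Properties as AllPairsₚ
open import Data.List.Relation.Binary.Disjoint.Propositional using (Disjoint)
open import Data.List.Relation.Unary.Unique.Propositional using (Unique)
import Data.List.Relation.Unary.Unique.Propositional.Properties as Unique
open import Data.Vec as Vec using (Vec; []; _∷_; lookup; tabulate; updateAt)
open import Data.Vec.Properties
  using (∷-injectiveˡ; ∷-injectiveʳ; lookup∘tabulate; tabulate∘lookup; tabulate-cong;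
         lookup∘updateAt; updateAt-updateAt; updateAt-updateAt-local; updateAt-id)
open import Data.Product using (∃; _,_; proj₁; proj₂) renaming (_×_ to _∧_)
open import Data.Empty using (⊥-elim)
open import Function.Bundles using (mk⇔)
open import Function.Definitions using (Injective)
open import Relation.Nullary using (¬_; yes; no)
open import Relation.Nullary.Decidable using (_×-dec_; ¬?)
open import Relation.Unary using (Pred; Decidable)
open import Relation.Binary.PropositionalEquality as ≡ using (_≡_; _≢_)
import Algebra.Bundles as AB
import Algebra.Definitions.RawSemiring as RawSemiring
import Algebra.Properties.CommutativeMonoid.Sum as Sum
import Algebra.Properties.CommutativeMonoid.Mult as CommMult
import Algebra.Properties.CommutativeSemigroup as CommSemigroupProperties
import Algebra.Properties.Semiring.Mult as SemiringMult
import Algebra.Properties.Group as GroupProperties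
import Relation.Binary.Reasoning.Setoid as SetoidReasoning

module _ {a} {A : Set a} where

  length-filter-split : ∀ {p r} {P : Pred A p} {R : Pred A r} (P? : Decidable P) (R? : Decidable R) xs →
    length (filter R? xs) ≡
      length (filter (λ x → P? x ×-dec R? x) xs) ℕ.+ length (filter (λ x → ¬? (P? x) ×-dec R? x) xs)
  length-filter-split P? R? [] = ≡.refl
  length-filter-split P? R? (x ∷ xs) with P? x | R? x
  ... | yes _ | yes _ = ≡.cong suc (length-filter-split P? R? xs)
  ... | no _  | yes _ = ≡.trans (≡.cong suc (length-filter-split P? R? xs)) (≡.sym (ℕₚ.+-suc _ _))
  ... | yes _ | no _  = length-filter-split P? R? xs
  ... | no _  | no _  = length-filter-split P? R? xs

  length-≡-by-bijection : ∀ {b} {B : Set b} {xs : List A} {ys : List B} (f : A → B) →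
    Injective _≡_ _≡_ f → Unique xs → Unique ys →
    (∀ {x} → x ∈ xs → f x ∈ ys) → (∀ {y} → y ∈ ys → ∃ λ x → x ∈ xs ∧ f x ≡ y) →
    length xs ≡ length ys
  length-≡-by-bijection {xs = xs} {ys} f f-inj xs! ys! into onto =
    ≡.trans (≡.sym (length-map f xs))
      (↭-length (∼bag⇒↭ (unique∧set⇒bag (Unique.map⁺ f-inj xs!) ys! (mk⇔ into′ onto′))))
    where
    into′ : ∀ {y} → y ∈ map f xs → y ∈ ys
    into′ y∈ with ∈-map⁻ f y∈
    ... | x , x∈ , ≡.refl = into x∈
    onto′ : ∀ {y} → y ∈ ys → y ∈ map f xs
    onto′ y∈ with onto y∈
    ... | x , x∈ , ≡.refl = ∈-map⁺ f x∈

module _ {a} {A : Set a} where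

  permute : ∀ {m n} → Permutation m n → Vec A n → Vec A m
  permute π v = tabulate (λ i → lookup v (π ⟨$⟩ʳ i))

  permute-flip : ∀ {m n} (π : Permutation m n) (v : Vec A n) → permute (flip π) (permute π v) ≡ v
  permute-flip π v = ≡.trans
    (tabulate-cong λ j → ≡.trans (lookup∘tabulate _ (π ⟨$⟩ˡ j)) (≡.cong (lookup v) (inverseʳ π)))
    (tabulate∘lookup v)

  permute-injective : ∀ {m n} (π : Permutation m n) → Injective _≡_ _≡_ (permute π)
  permute-injective π {v} {w} πv≡πw = ≡.trans (≡.sym (permute-flip π v))
    (≡.trans (≡.cong (permute (flip π)) πv≡πw) (permute-flip π w))

sum≡∑lookup : ∀ {n} (v : Vec ℕ n) → Vec.sum v ≡ Sum.sum ℕₚ.+-0-commutativeMonoid (lookup v)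
sum≡∑lookup []       = ≡.refl
sum≡∑lookup (k ∷ ks) = ≡.cong (k ℕ.+_) (sum≡∑lookup ks)

sum-permute : ∀ {m n} (π : Permutation m n) (v : Vec ℕ n) → Vec.sum (permute π v) ≡ Vec.sum v
sum-permute π v = begin
  Vec.sum (permute π v)         ≡⟨ sum≡∑lookup (permute π v) ⟩
  ∑ (lookup (permute π v))      ≡⟨ sum-cong-≗ (lookup∘tabulate (λ i → lookup v (π ⟨$⟩ʳ i))) ⟩
  ∑ (λ i → lookup v (π ⟨$⟩ʳ i)) ≡⟨ ∑-permute (lookup v) π ⟨
  ∑ (lookup v)                  ≡⟨ sum≡∑lookup v ⟨
  Vec.sum v                     ∎
  where
  open ≡.≡-Reasoning
  open Sum ℕₚ.+-0-commutativeMonoid using (sum-cong-≗; ∑-permute) renaming (sum to ∑)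

sum-updateAt-suc : ∀ {n} (v : Vec ℕ n) i → Vec.sum (updateAt v i suc) ≡ suc (Vec.sum v)
sum-updateAt-suc (k ∷ ks) Fin.zero    = ≡.refl
sum-updateAt-suc (k ∷ ks) (Fin.suc i) =
  ≡.trans (≡.cong (k ℕ.+_) (sum-updateAt-suc ks i)) (ℕₚ.+-suc k (Vec.sum ks))

module _ {c ℓ} (F : FiniteField c ℓ) where

  open FiniteField F hiding (zero)
  open RawSemiring (AB.Semiring.rawSemiring semiring) using () renaming (_×_ to _·_)
  open SemiringMult semiring using (×-homo-+; ×-congʳ; ×-assoc-*; ×1-homo-*)
  open CommMult +-commutativeMonoid using (×-distrib-+)
  open Sum +-commutativeMonoid using (sum-cong-≗; sum-cong-≋; ∑-distrib-+; ∑-permute) renaming (sum to ∑)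
  open CommSemigroupProperties +-commutativeSemigroup using (x∙yz≈y∙xz)
  open GroupProperties +-group using (∙-cancelʳ; //-rightDividesˡ; //-rightDividesʳ)
  open SetoidReasoning setoid

  ∈-compositions⁻ : ∀ n m {v} → v ∈ compositions F n m → Vec.sum v ≡ m
  ∈-compositions⁻ zero    zero    {[]} _ = ≡.refl
  ∈-compositions⁻ zero    (suc m) ()
  ∈-compositions⁻ (suc n) m       v∈ with find (∈-concatMap⁻ _ {xs = upTo (suc m)} v∈)
  ... | k , k∈ , v∈k with ∈-map⁻ (k ∷_) v∈k
  ... | w , w∈ , ≡.refl = ≡.trans (≡.cong (k ℕ.+_) (∈-compositions⁻ n (m ∸ k) w∈))
                                  (ℕₚ.m+[n∸m]≡n (ℕₚ.≤-pred (∈-upTo⁻ k∈)))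

  ∈-compositions⁺ : ∀ n m {v} → Vec.sum v ≡ m → v ∈ compositions F n m
  ∈-compositions⁺ zero    _ {[]}    ≡.refl = here ≡.refl
  ∈-compositions⁺ (suc n) _ {k ∷ w} ≡.refl =
    ∈-concatMap⁺ _ {xs = upTo (suc (k ℕ.+ Vec.sum w))}
      (lose (∈-upTo⁺ (s≤s (ℕₚ.m≤m+n k (Vec.sum w))))
            (∈-map⁺ (k ∷_) (∈-compositions⁺ n _ (≡.sym (ℕₚ.m+n∸m≡n k (Vec.sum w))))))

  compositions-unique : ∀ n m → Unique (compositions F n m)
  compositions-unique zero    zero    = All.[] AllPairs.∷ AllPairs.[]
  compositions-unique zero    (suc m) = AllPairs.[]
  compositions-unique (suc n) m       = Unique.concat⁺
    (Allₚ.map⁺ (All.universal (λ k → Unique.map⁺ ∷-injectiveʳ (compositions-unique n (m ∸ k))) _))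
    (AllPairsₚ.map⁺ (AllPairs.map disjoint (Unique.upTo⁺ (suc m))))
    where
    disjoint : ∀ {k l} → k ≢ l →
               Disjoint (map (k ∷_) (compositions F n (m ∸ k))) (map (l ∷_) (compositions F n (m ∸ l)))
    disjoint k≢l (v∈k , v∈l) with ∈-map⁻ _ v∈k | ∈-map⁻ _ v∈l
    ... | _ , _ , ≡.refl | _ , _ , v≡l∷ = k≢l (∷-injectiveˡ v≡l∷)

  weightedSum≈∑ : ∀ {n} (cs : Vec ℕ n) e → weightedSum F cs e ≈ ∑ (λ i → lookup cs i · e i)
  weightedSum≈∑ []       e = refl
  weightedSum≈∑ (k ∷ ks) e = +-congˡ (weightedSum≈∑ ks (λ i → e (Fin.suc i)))

  weightedSum-cong : ∀ {n} (cs : Vec ℕ n) {e e′} → (∀ i → e i ≈ e′ i) →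
                     weightedSum F cs e ≈ weightedSum F cs e′
  weightedSum-cong []       e≈e′ = refl
  weightedSum-cong (k ∷ ks) e≈e′ =
    +-cong (×-congʳ k (e≈e′ Fin.zero)) (weightedSum-cong ks (λ i → e≈e′ (Fin.suc i)))

  ∑-·-const : ∀ {n} (cs : Vec ℕ n) a → ∑ (λ i → lookup cs i · a) ≈ Vec.sum cs · a
  ∑-·-const []       a = refl
  ∑-·-const (k ∷ ks) a = trans (+-congˡ (∑-·-const ks a)) (sym (×-homo-+ a k (Vec.sum ks)))

  weightedSum-permute : ∀ {m n} (π : Permutation m n) (cs : Vec ℕ n) e →
    weightedSum F (permute π cs) e ≈ weightedSum F cs (λ i → e (π ⟨$⟩ˡ i))
  weightedSum-permute {m} π cs e = begin
    weightedSum F (permute π cs) e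
      ≈⟨ weightedSum≈∑ (permute π cs) e ⟩
    ∑ (λ j → lookup (permute π cs) j · e j)
      ≡⟨ sum-cong-≗ (λ j → ≡.cong (_· e j) (lookup∘tabulate _ j)) ⟩
    ∑ (λ j → μ (π ⟨$⟩ʳ j) · e j)
      ≈⟨ sum-cong-≋ {m} (λ j → ×-congʳ (μ (π ⟨$⟩ʳ j)) (reflexive (≡.cong e (inverseˡ π)))) ⟨
    ∑ (λ j → μ (π ⟨$⟩ʳ j) · e (π ⟨$⟩ˡ (π ⟨$⟩ʳ j)))
      ≈⟨ ∑-permute (λ i → μ i · e (π ⟨$⟩ˡ i)) π ⟨
    ∑ (λ i → μ i · e (π ⟨$⟩ˡ i))
      ≈⟨ weightedSum≈∑ cs _ ⟨
    weightedSum F cs (λ i → e (π ⟨$⟩ˡ i))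
      ∎
    where
    μ : Fin _ → ℕ
    μ = lookup cs

  weightedSum-+-const : ∀ {n} (cs : Vec ℕ n) e a →
    weightedSum F cs (λ i → e i + a) ≈ weightedSum F cs e + Vec.sum cs · a
  weightedSum-+-const cs e a = begin
    weightedSum F cs (λ i → e i + a)          ≈⟨ weightedSum≈∑ cs _ ⟩
    ∑ (λ i → μ i · (e i + a))                 ≈⟨ sum-cong-≋ (λ i → ×-distrib-+ (e i) a (μ i)) ⟩
    ∑ (λ i → μ i · e i + μ i · a)             ≈⟨ ∑-distrib-+ (λ i → μ i · e i) (λ i → μ i · a) ⟩
    ∑ (λ i → μ i · e i) + ∑ (λ i → μ i · a)   ≈⟨ +-cong (sym (weightedSum≈∑ cs e)) (∑-·-const cs a) ⟩
    weightedSum F cs e + Vec.sum cs · a       ∎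
    where
    μ : Fin _ → ℕ
    μ = lookup cs

  weightedSum-updateAt-suc : ∀ {n} (cs : Vec ℕ n) i e →
    weightedSum F (updateAt cs i suc) e ≈ e i + weightedSum F cs e
  weightedSum-updateAt-suc (k ∷ ks) Fin.zero    e = +-assoc _ _ _
  weightedSum-updateAt-suc (k ∷ ks) (Fin.suc i) e =
    trans (+-congˡ (weightedSum-updateAt-suc ks i (λ j → e (Fin.suc j)))) (x∙yz≈y∙xz _ _ _)

  translation : Carrier → Permutation q q
  translation a = permutation (shiftBy a) (shiftBy (- a))
    (shiftBy-shiftBy a (- a) (//-rightDividesˡ a)) (shiftBy-shiftBy (- a) a (//-rightDividesʳ a))
    where
    shiftBy : Carrier → Fin q → Fin q
    shiftBy b i = proj₁ (enum-surj (enum i + b))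
    enum-shiftBy : ∀ b i → enum (shiftBy b i) ≈ enum i + b
    enum-shiftBy b i = proj₂ (enum-surj (enum i + b))
    shiftBy-shiftBy : ∀ b b′ → (∀ x → x + b′ + b ≈ x) → ∀ i → shiftBy b (shiftBy b′ i) ≡ i
    shiftBy-shiftBy b b′ cancel i = enum-inj _ _
      (trans (enum-shiftBy b _) (trans (+-congʳ (enum-shiftBy b′ i)) (cancel (enum i))))

  enum-translation : ∀ a i → enum (translation a ⟨$⟩ʳ i) ≈ enum i + a
  enum-translation a i = proj₂ (enum-surj (enum i + a))

  -- The multiplicity of x + a in  translate a cs  is that of x in cs.
  translate : Carrier → Vec ℕ q → Vec ℕ q
  translate a = permute (flip (translation a))

  weightedSum-translate : ∀ a cs →
    weightedSum F (translate a cs) enum ≈ weightedSum F cs enum + Vec.sum cs · a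
  weightedSum-translate a cs = trans (weightedSum-permute (flip (translation a)) cs enum)
    (trans (weightedSum-cong cs (enum-translation a)) (weightedSum-+-const cs enum a))

  sumsTo? : ∀ z → Decidable (λ cs → weightedSum F cs enum ≈ z)
  sumsTo? z cs = _≟F_ F (weightedSum F cs enum) z

  P : ℕ → Carrier → ℕ
  P m z = length (filter (sumsTo? z) (compositions F q m))

  P-translate : ∀ m a {z w} → z + m · a ≈ w → P m z ≡ P m w
  P-translate m a {z} {w} z+ma≈w =
    length-≡-by-bijection (translate a) (permute-injective (flip (translation a)))
      (Unique.filter⁺ _ (compositions-unique q m)) (Unique.filter⁺ _ (compositions-unique q m))
      into onto
    where
    into : ∀ {cs} → cs ∈ filter (sumsTo? z) (compositions F q m) →
           translate a cs ∈ filter (sumsTo? w) (compositions F q m)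
    into {cs} cs∈ with ∈-filter⁻ (sumsTo? z) cs∈
    ... | cs∈m , cs↦z = ∈-filter⁺ (sumsTo? w)
      (∈-compositions⁺ q m (≡.trans (sum-permute (flip (translation a)) cs) Σcs≡m)) (begin
      weightedSum F (translate a cs) enum    ≈⟨ weightedSum-translate a cs ⟩
      weightedSum F cs enum + Vec.sum cs · a ≡⟨ ≡.cong (λ k → weightedSum F cs enum + k · a) Σcs≡m ⟩
      weightedSum F cs enum + m · a          ≈⟨ +-congʳ cs↦z ⟩
      z + m · a                              ≈⟨ z+ma≈w ⟩
      w                                      ∎)
      where
      Σcs≡m : Vec.sum cs ≡ m
      Σcs≡m = ∈-compositions⁻ q m cs∈m
    onto : ∀ {ds} → ds ∈ filter (sumsTo? w) (compositions F q m) →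
           ∃ λ cs → cs ∈ filter (sumsTo? z) (compositions F q m) ∧ translate a cs ≡ ds
    onto {ds} ds∈ with ∈-filter⁻ (sumsTo? w) ds∈
    ... | ds∈m , ds↦w = cs , ∈-filter⁺ (sumsTo? z) (∈-compositions⁺ q m Σcs≡m) cs↦z , translate-cs≡ds
      where
      cs : Vec ℕ q
      cs = permute (translation a) ds
      translate-cs≡ds : translate a cs ≡ ds
      translate-cs≡ds = permute-flip (translation a) ds
      Σcs≡m : Vec.sum cs ≡ m
      Σcs≡m = ≡.trans (sum-permute (translation a) ds) (∈-compositions⁻ q m ds∈m)
      cs↦z : weightedSum F cs enum ≈ z
      cs↦z = ∙-cancelʳ (m · a) _ _ (begin
        weightedSum F cs enum + m · a          ≡⟨ ≡.cong (λ k → weightedSum F cs enum + k · a) Σcs≡m ⟨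
        weightedSum F cs enum + Vec.sum cs · a ≈⟨ weightedSum-translate a cs ⟨
        weightedSum F (translate a cs) enum    ≡⟨ ≡.cong (λ v → weightedSum F v enum) translate-cs≡ds ⟩
        weightedSum F ds enum                  ≈⟨ ds↦w ⟩
        w                                      ≈⟨ z+ma≈w ⟨
        z + m · a                              ∎)

  P-0≡P-1 : ∀ m → ¬ (m · 1# ≈ 0#) → P m 0# ≡ P m 1#
  P-0≡P-1 m m≉0 with inverse (m · 1#) m≉0
  ... | b , m1*b≈1 = P-translate m b (begin
    0# + m · b          ≈⟨ +-identityˡ (m · b) ⟩
    m · b               ≈⟨ ×-congʳ m (*-identityˡ b) ⟨
    m · (1# * b)        ≈⟨ ×-assoc-* m 1# b ⟨
    (m · 1#) * b        ≈⟨ m1*b≈1 ⟩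
    1#                  ∎)

  zeroIndex : Fin q
  zeroIndex = proj₁ (enum-surj 0#)

  addZero : Vec ℕ q → Vec ℕ q
  addZero cs = updateAt cs zeroIndex suc

  addZero-injective : Injective _≡_ _≡_ addZero
  addZero-injective {cs} {ds} eq = ≡.trans (≡.sym (removeZero-addZero cs))
    (≡.trans (≡.cong (λ v → updateAt v zeroIndex ℕ.pred) eq) (removeZero-addZero ds))
    where
    removeZero-addZero : ∀ cs → updateAt (addZero cs) zeroIndex ℕ.pred ≡ cs
    removeZero-addZero cs = ≡.trans (updateAt-updateAt zeroIndex cs) (updateAt-id zeroIndex cs)

  enum-zeroIndex : enum zeroIndex ≈ 0#
  enum-zeroIndex = proj₂ (enum-surj 0#)

  avoidsZero⇒lookup≡0 : ∀ cs → AvoidsZero F cs → lookup cs zeroIndex ≡ 0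
  avoidsZero⇒lookup≡0 _ avoids = avoids zeroIndex enum-zeroIndex

  lookup≡0⇒avoidsZero : ∀ cs → lookup cs zeroIndex ≡ 0 → AvoidsZero F cs
  lookup≡0⇒avoidsZero cs c₀≡0 i enum-i≈0 =
    ≡.subst (λ j → lookup cs j ≡ 0) (enum-inj zeroIndex i (trans enum-zeroIndex (sym enum-i≈0))) c₀≡0

  containsZero? : ∀ z → Decidable (λ cs → ¬ AvoidsZero F cs ∧ weightedSum F cs enum ≈ z)
  containsZero? z cs = ¬? (avoidsZero? F cs) ×-dec sumsTo? z cs

  P≡length-filter-containsZero : ∀ m z → P m z ≡ length (filter (containsZero? z) (compositions F q (suc m)))
  P≡length-filter-containsZero m z =
    length-≡-by-bijection addZero addZero-injective
      (Unique.filter⁺ _ (compositions-unique q m)) (Unique.filter⁺ _ (compositions-unique q (suc m)))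
      into onto
    where
    into : ∀ {cs} → cs ∈ filter (sumsTo? z) (compositions F q m) →
           addZero cs ∈ filter (containsZero? z) (compositions F q (suc m))
    into {cs} cs∈ with ∈-filter⁻ (sumsTo? z) cs∈
    ... | cs∈m , cs↦z = ∈-filter⁺ (containsZero? z)
      (∈-compositions⁺ q (suc m)
        (≡.trans (sum-updateAt-suc cs zeroIndex) (≡.cong suc (∈-compositions⁻ q m cs∈m))))
      ( (λ avoids → ℕₚ.0≢1+n (≡.trans (≡.sym (avoidsZero⇒lookup≡0 (addZero cs) avoids))
                                      (lookup∘updateAt zeroIndex {suc} cs)))
      , (begin
        weightedSum F (addZero cs) enum        ≈⟨ weightedSum-updateAt-suc cs zeroIndex enum ⟩
        enum zeroIndex + weightedSum F cs enum ≈⟨ +-cong enum-zeroIndex cs↦z ⟩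
        0# + z                                 ≈⟨ +-identityˡ z ⟩
        z                                      ∎))
    onto : ∀ {ds} → ds ∈ filter (containsZero? z) (compositions F q (suc m)) →
           ∃ λ cs → cs ∈ filter (sumsTo? z) (compositions F q m) ∧ addZero cs ≡ ds
    onto {ds} ds∈ with ∈-filter⁻ (containsZero? z) ds∈
    ... | ds∈m , ¬avoids , ds↦z =
      cs , ∈-filter⁺ (sumsTo? z) (∈-compositions⁺ q m Σcs≡m) cs↦z , addZero-cs≡ds
      where
      cs : Vec ℕ q
      cs = updateAt ds zeroIndex ℕ.pred
      addZero-cs≡ds : addZero cs ≡ ds
      addZero-cs≡ds = ≡.trans
        (updateAt-updateAt-local zeroIndex ds
          (ℕₚ.suc-pred _ {{ℕ.≢-nonZero (λ d₀≡0 → ¬avoids (lookup≡0⇒avoidsZero ds d₀≡0))}}))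
        (updateAt-id zeroIndex ds)
      Σcs≡m : Vec.sum cs ≡ m
      Σcs≡m = ℕₚ.suc-injective (≡.trans (≡.sym (sum-updateAt-suc cs zeroIndex))
        (≡.trans (≡.cong Vec.sum addZero-cs≡ds) (∈-compositions⁻ q (suc m) ds∈m)))
      cs↦z : weightedSum F cs enum ≈ z
      cs↦z = begin
        weightedSum F cs enum                  ≈⟨ +-identityˡ _ ⟨
        0# + weightedSum F cs enum             ≈⟨ +-congʳ enum-zeroIndex ⟨
        enum zeroIndex + weightedSum F cs enum ≈⟨ weightedSum-updateAt-suc cs zeroIndex enum ⟨
        weightedSum F (addZero cs) enum        ≡⟨ ≡.cong (λ v → weightedSum F v enum) addZero-cs≡ds ⟩
        weightedSum F ds enum                  ≈⟨ ds↦z ⟩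
        z                                      ∎

  P-suc : ∀ m z → P (suc m) z ≡ Ptilde F (suc m) z ℕ.+ P m z
  P-suc m z = ≡.trans (length-filter-split (avoidsZero? F) (sumsTo? z) (compositions F q (suc m)))
    (≡.cong (Ptilde F (suc m) z ℕ.+_) (≡.sym (P≡length-filter-containsZero m z)))

  characteristic∤⇒·1≉0 : ∀ {p} n → IsCharacteristic F p → ¬ (p ∣ n) → ¬ (n · 1# ≈ 0#)
  characteristic∤⇒·1≉0 {zero}      n (() , _)
  characteristic∤⇒·1≉0 p@{suc p-1} n (_ , p·1≈0 , minimal) p∤n n·1≈0 with n % p in n%p≡r
  ... | zero  = p∤n (m%n≡0⇒n∣m n p n%p≡r)
  ... | suc r = minimal (suc r) (s≤s z≤n) (≡.subst (_< p) n%p≡r (m%n<n n p)) (begin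
    suc r · 1#                           ≈⟨ +-identityʳ _ ⟨
    suc r · 1# + 0#                      ≈⟨ +-congˡ [n/p]p·1≈0 ⟨
    suc r · 1# + (n / p ℕ.* p) · 1#      ≈⟨ ×-homo-+ 1# (suc r) (n / p ℕ.* p) ⟨
    (suc r ℕ.+ n / p ℕ.* p) · 1#         ≡⟨ ≡.cong (λ k → (k ℕ.+ n / p ℕ.* p) · 1#) n%p≡r ⟨
    (n % p ℕ.+ n / p ℕ.* p) · 1#         ≡⟨ ≡.cong (_· 1#) (m≡m%n+[m/n]*n n p) ⟨
    n · 1#                               ≈⟨ n·1≈0 ⟩
    0#                                   ∎)
    where
    [n/p]p·1≈0 : (n / p ℕ.* p) · 1# ≈ 0#
    [n/p]p·1≈0 = trans (×1-homo-* (n / p) p) (trans (*-congˡ p·1≈0) (zeroʳ _))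

lemma2 : ∀ {c ℓ} (F : FiniteField c ℓ) (p m : ℕ) →
         IsCharacteristic F p →
         0 < m → ¬ (p ∣ m) → ¬ (p ∣ (m ∸ 1)) →
         Ptilde F m (FiniteField.0# F) ≡ Ptilde F m (FiniteField.1# F)
lemma2 F p (suc zero)      _    _ _     p∤0 = ⊥-elim (p∤0 (p ∣0))
lemma2 F p (suc m@(suc _)) char _ p∤m+1 p∤m = ℕₚ.+-cancelʳ-≡ (P F m 0#) _ _ (begin
  Ptilde F (suc m) 0# ℕ.+ P F m 0#  ≡⟨ P-suc F m 0# ⟨
  P F (suc m) 0#                    ≡⟨ P-0≡P-1 F (suc m) (characteristic∤⇒·1≉0 F (suc m) char p∤m+1) ⟩
  P F (suc m) 1#                    ≡⟨ P-suc F m 1# ⟩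
  Ptilde F (suc m) 1# ℕ.+ P F m 1#  ≡⟨ ≡.cong (Ptilde F (suc m) 1# ℕ.+_) Pₘ-0≡Pₘ-1 ⟨
  Ptilde F (suc m) 1# ℕ.+ P F m 0#  ∎)
  where
  open FiniteField F using (0#; 1#)
  open ≡.≡-Reasoning
  Pₘ-0≡Pₘ-1 : P F m 0# ≡ P F m 1#
  Pₘ-0≡Pₘ-1 = P-0≡P-1 F m (characteristic∤⇒·1≉0 F m char p∤m)
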